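{- Let $A,B\in\mathbb Z$, $m>0$ and $n,d\ge0$ be integers, and let \[ F=(1+\beta w)^A(1+\beta u^{ -1})^B\,\frac{\prod_{k=1}^{m-1}(1-uc_k)}{\prod_{k=1}^n(1-w^{ -1}b_k)}\,\frac{uw}{1-uw}, \] expanded via $(1+\beta w)^A=\sum_{l\ge0}\binom{A}{l}\beta^lw^l$, $(1+\beta u^{ -1})^B=\sum_{l\ge0}\binom{B}{l}\beta^lu^{ -l}$, $(1-w^{ -1}b_k)^{ -1}=\sum_{j\ge0}b_k^jw^{ -j}$, $\frac{uw}{1-uw}=\sum_{p\ge1}u^pw^p$. Then \[ [u^{m+d}w^n]\,F=\sum_{l\ge0}\binom{A+B}{l}\beta^l\,h_{l-n+m+d}(b_1,\ldots,b_n;-c_1,\ldots,-c_{m-1}). \]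
   Context: $\beta,b_k,c_k,u,w$ are indeterminates; the coefficient of $u^{m+d}w^n$ is a well-defined formal power series in $\beta$ with polynomial coefficients in the $b$'s and $c$'s. $\binom{a}{l}=a(a-1)\cdots(a-l+1)/l!$ is the generalized binomial coefficient. Supersymmetric complete functions: $\sum_{p\ge0}h_p(x_1,\ldots,x_s;y_1,\ldots,y_t)z^p=\prod_{j=1}^t(1+y_jz)/\prod_{i=1}^s(1-x_iz)$, with $h_p=0$ for $p<0$. -}

module Defs where

open import Level using (Level)
open import Algebra.Bundles using (CommutativeRing)
open import Data.Nat as ℕ using (ℕ; zero; suc; _∸_; _!)
open import Data.Nat.Properties using (_!≢0)
open import Data.Nat.Base using (_≡ᵇ_; _≤ᵇ_)
open import Data.Bool using (Bool; true; false; _∧_; if_then_else_)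
open import Data.Integer as ℤ using (ℤ; +_; -[1+_])
open import Data.Integer.DivMod using (_/ℕ_)
open import Data.Fin using (Fin; zero; suc)

-- Generalized binomial coefficient for an integer top argument:
--   binom a l = a (a-1) ... (a-l+1) / l!   (exact division in ℤ)

fallingℤ : ℤ → ℕ → ℤ
fallingℤ a zero    = + 1
fallingℤ a (suc l) = fallingℤ a l ℤ.* (a ℤ.- + l)

binomℤ : ℤ → ℕ → ℤ
binomℤ a l = (fallingℤ a l /ℕ (l !)) {{l !≢0}}

-- Everything below is relative to a commutative ring R of coefficients
-- (the indeterminates b_k, c_k are arbitrary elements of R; taking R to
-- be the polynomial ring ℤ[b,c] recovers the polynomial identity).

module Series {c ℓ : Level} (R : CommutativeRing c ℓ) where
  open CommutativeRing R hiding (zero)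

  natR : ℕ → Carrier
  natR zero    = 0#
  natR (suc n) = 1# + natR n

  intR : ℤ → Carrier
  intR (+ n)     = natR n
  intR -[1+ n ]  = - natR (suc n)

  sumR : ℕ → (ℕ → Carrier) → Carrier
  sumR zero    f = 0#
  sumR (suc N) f = sumR N f + f N

  [_]R : Bool → Carrier
  [ true  ]R = 1#
  [ false ]R = 0#

  PS : Set c
  PS = ℕ → Carrier

  oneS : PS
  oneS zero    = 1#
  oneS (suc _) = 0#

  _⊛_ : PS → PS → PS
  (f ⊛ g) n = sumR (suc n) (λ i → f i * g (n ∸ i))

  prodS : (k : ℕ) → (Fin k → PS) → PS
  prodS zero    F = oneS
  prodS (suc k) F = F zero ⊛ prodS k (λ i → F (suc i))

  linS : Carrier → PS
  linS y zero          = 1#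
  linS y (suc zero)    = y
  linS y (suc (suc _)) = 0#

  geomS : Carrier → PS
  geomS x zero    = 1#
  geomS x (suc j) = x * geomS x j

  -- supersymmetric complete function h_p(x_1..x_s ; y_1..y_t), p ∈ ℤ,
  -- defined by Σ_p h_p z^p = Π_j (1 + y_j z) / Π_i (1 - x_i z), h_p = 0 for p < 0
  hSuper : (s t : ℕ) → (Fin s → Carrier) → (Fin t → Carrier) → ℤ → Carrier
  hSuper s t x y (+ p)    = (prodS t (λ j → linS (y j)) ⊛ prodS s (λ i → geomS (x i))) p
  hSuper s t x y -[1+ _ ] = 0#

  -- Coefficient of β^L u^(m+d) w^n in
  --   F = (1+βw)^A (1+βu⁻¹)^B Π_{k<m-1}(1-u c_k) / Π_{k<n}(1-w⁻¹ b_k) · uw/(1-uw)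
  -- computed by multiplying out the five expansions of the statement:
  --   (1+βw)^A      = Σ_{l₁} binom(A,l₁) β^{l₁} w^{l₁}
  --   (1+βu⁻¹)^B    = Σ_{l₂} binom(B,l₂) β^{l₂} u^{-l₂}
  --   Π(1-u c_k)    = Σ_q  P_q u^q           (P = prodS of linS (- c_k))
  --   Π 1/(1-w⁻¹b_k)= Σ_j  H_j w^{-j}         (H = prodS of geomS b_k)
  --   uw/(1-uw)     = Σ_{p≥1} u^p w^p
  -- A term (l₁,l₂,q,j,p) contributes to β^L u^(m+d) w^n iff
  --   l₁ + l₂ = L,  q + p - l₂ = m + d,  l₁ - j + p = n,  p ≥ 1.
  -- All such indices are < Nb = 2L + m + d + n + 2, so the (finite) sum
  -- over the box [0,Nb)^5 with indicator of the constraints is exact.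
  coeffF : (A B : ℤ) (m n d : ℕ) (b : Fin n → Carrier) (c : Fin (m ∸ 1) → Carrier)
           (L : ℕ) → Carrier
  coeffF A B m n d b c L =
    sumR Nb λ l₁ → sumR Nb λ l₂ → sumR Nb λ q → sumR Nb λ j → sumR Nb λ p →
      [ ((l₁ ℕ.+ l₂) ≡ᵇ L) ∧ ((q ℕ.+ p) ≡ᵇ (m ℕ.+ d ℕ.+ l₂))
        ∧ ((l₁ ℕ.+ p) ≡ᵇ (n ℕ.+ j)) ∧ (1 ≤ᵇ p) ]R
      * (intR (binomℤ A l₁) * intR (binomℤ B l₂)
         * prodS (m ∸ 1) (λ k → linS (- c k)) q
         * prodS n (λ k → geomS (b k)) j)
    where Nb = 2 ℕ.* L ℕ.+ m ℕ.+ d ℕ.+ n ℕ.+ 2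

{-# OPTIONS --safe #-}
module Submission where

-- In the five-fold sum defining the coefficient, the exponent of u forces
-- p = m + d + l₂ - q, and this p is positive because Π (1 - u c_k) has degree
-- m - 1 < m.  What remains are the two independent constraints l₁ + l₂ = L and
-- q + j = L + m + d - n, so the coefficient splits into a product:
-- Σ_{l₁+l₂=L} binom(A,l₁) binom(B,l₂), which is binom(A+B,L) by Chu–Vandermonde,
-- times the coefficient of z^(L+m+d-n) in Π (1 - c_k z) / Π (1 - b_k z), which
-- is h by definition (and 0 when that exponent is negative).  Vandermonde for
-- integer tops follows by induction on A in both directions from A = 0 using
-- Pascal's rule, which for the defined binomℤ rests on l! dividing the falling
-- factorial.

open import Defs
open import Level using (Level)
open import Algebra.Bundles using (CommutativeRing)
open import Data.Nat using (ℕ; _∸_; _<_)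
open import Data.Integer using (ℤ)
open import Data.Fin using (Fin)

import Algebra.Properties.CommutativeSemigroup as CommutativeSemigroupProperties
open import Data.Bool using (Bool; true; false; _∧_; T)
open import Data.Bool.Properties using (T-∧)
open import Data.Empty using (⊥-elim)
import Data.Fin as Fin
open import Data.Nat as ℕ using (zero; suc; _≤_; _!; _≡ᵇ_; _≤ᵇ_; z≤n; s≤s)
import Data.Nat.DivMod as ℕ
import Data.Nat.Properties as ℕ
open import Data.Nat.Properties using (_!≢0)
open import Data.Integer as ℤ using (+_; -[1+_])
import Data.Integer.Properties as ℤ
open import Data.Product using (proj₁; proj₂; _,_)
open import Data.Sum using (inj₁; inj₂)
open import Data.Unit using (tt)
open import Function.Bundles using (Equivalence; _⇔_; mk⇔)
open import Relation.Nullary using (yes; no; ¬_)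
open import Relation.Binary.PropositionalEquality as ≡ using (_≡_; _≢_)

module ℕ+ = CommutativeSemigroupProperties ℕ.+-commutativeSemigroup
module ℤ+ = CommutativeSemigroupProperties ℤ.+-commutativeSemigroup

module _ where
  open import Data.Integer using (_+_; _*_; _-_; -_)
  open import Data.Integer.DivMod using (_/ℕ_)
  open import Data.Integer.Divisibility.Signed
    using (_∣_; divides; ∣m∣n⇒∣m+n; ∣m+n∣n⇒∣m; *-monoʳ-∣)
  open import Data.Integer.Tactic.RingSolver using (solve-∀)
  open ≡ using (refl; sym; trans; cong; cong₂; subst)
  open ≡.≡-Reasoning

  ℤ-induction : ∀ {p} (P : ℤ → Set p) → P (+ 0) →
                (∀ a → P a → P (a + + 1)) → (∀ a → P (a + + 1) → P a) → ∀ a → P a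
  ℤ-induction P P0 up down (+ n)    = nonNegative n
    where
    nonNegative : ∀ n → P (+ n)
    nonNegative zero    = P0
    nonNegative (suc n) = subst P (cong +_ (ℕ.+-comm n 1)) (up (+ n) (nonNegative n))
  ℤ-induction P P0 up down -[1+ n ] = negative n
    where
    negative : ∀ n → P -[1+ n ]
    negative zero    = down -[1+ 0 ] P0
    negative (suc n) = down -[1+ suc n ] (negative n)

  fallingℤ-shift : ∀ a l → fallingℤ (a + + 1) (suc l) ≡ (a + + 1) * fallingℤ a l
  fallingℤ-shift a zero    = identity a
    where
    identity : ∀ a → + 1 * ((a + + 1) - + 0) ≡ (a + + 1) * + 1
    identity = solve-∀
  fallingℤ-shift a (suc l) = begin
    fallingℤ (a + + 1) (suc l) * ((a + + 1) - + suc l)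
      ≡⟨ cong (_* ((a + + 1) - + suc l)) (fallingℤ-shift a l) ⟩
    (a + + 1) * fallingℤ a l * ((a + + 1) - (+ 1 + + l))
      ≡⟨ identity a (fallingℤ a l) (+ l) ⟩
    (a + + 1) * (fallingℤ a l * (a - + l))
      ∎
    where
    identity : ∀ a f l → (a + + 1) * f * ((a + + 1) - (+ 1 + l)) ≡ (a + + 1) * (f * (a - l))
    identity = solve-∀

  fallingℤ-pascal : ∀ a l →
                    fallingℤ (a + + 1) (suc l) ≡ fallingℤ a (suc l) + + suc l * fallingℤ a l
  fallingℤ-pascal a l = trans (fallingℤ-shift a l) (identity a (fallingℤ a l) (+ l))
    where
    identity : ∀ a f l → (a + + 1) * f ≡ f * (a - l) + (+ 1 + l) * f
    identity = solve-∀

  fallingℤ-0-suc : ∀ l → fallingℤ (+ 0) (suc l) ≡ + 0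
  fallingℤ-0-suc zero    = refl
  fallingℤ-0-suc (suc l) =
    trans (cong (_* (+ 0 - + suc l)) (fallingℤ-0-suc l)) (ℤ.*-zeroˡ (+ 0 - + suc l))

  !∣fallingℤ : ∀ l a → + (l !) ∣ fallingℤ a l
  !∣fallingℤ zero    a = divides (fallingℤ a 0) refl
  !∣fallingℤ (suc l)   = ℤ-induction (λ a → + (suc l !) ∣ fallingℤ a (suc l)) base up down
    where
    base : + (suc l !) ∣ fallingℤ (+ 0) (suc l)
    base = divides (+ 0) (fallingℤ-0-suc l)
    ∣lower : ∀ a → + (suc l !) ∣ + suc l * fallingℤ a l
    ∣lower a = subst (_∣ + suc l * fallingℤ a l) (sym (ℤ.pos-* (suc l) (l !)))
                     (*-monoʳ-∣ (+ suc l) (!∣fallingℤ l a))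
    up : ∀ a → + (suc l !) ∣ fallingℤ a (suc l) → + (suc l !) ∣ fallingℤ (a + + 1) (suc l)
    up a ∣f = subst (_ ∣_) (sym (fallingℤ-pascal a l)) (∣m∣n⇒∣m+n ∣f (∣lower a))
    down : ∀ a → + (suc l !) ∣ fallingℤ (a + + 1) (suc l) → + (suc l !) ∣ fallingℤ a (suc l)
    down a ∣f = ∣m+n∣n⇒∣m (subst (_ ∣_) (fallingℤ-pascal a l) ∣f) (∣lower a)

  [i*k]/ℕk≡i : ∀ i k .{{_ : ℕ.NonZero k}} → (i * + k) /ℕ k ≡ i
  [i*k]/ℕk≡i (+ i)    k       = trans (cong (_/ℕ k) (sym (ℤ.pos-* i k))) (cong +_ (ℕ.m*n/n≡m i k))
  [i*k]/ℕk≡i -[1+ i ] (suc k) = divide (ℕ.m*n%n≡0 (suc i) (suc k))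
    where
    divide : suc i ℕ.* suc k ℕ.% suc k ≡ 0 → (-[1+ i ] * + suc k) /ℕ suc k ≡ -[1+ i ]
    divide rem≡0 rewrite rem≡0 = cong (λ n → - + n) (ℕ.m*n/n≡m (suc i) (suc k))

  !*binomℤ≡fallingℤ : ∀ a l → + (l !) * binomℤ a l ≡ fallingℤ a l
  !*binomℤ≡fallingℤ a l with !∣fallingℤ l a
  ... | divides q eq rewrite eq =
    trans (cong (+ (l !) *_) ([i*k]/ℕk≡i q (l !) {{l !≢0}})) (ℤ.*-comm _ q)

  binomℤ-pascal : ∀ a l → binomℤ (a + + 1) (suc l) ≡ binomℤ a (suc l) + binomℤ a l
  binomℤ-pascal a l = ℤ.*-cancelˡ-≡ (+ (suc l !)) _ _ {{suc l !≢0}} (begin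
    + (suc l !) * binomℤ (a + + 1) (suc l)
      ≡⟨ !*binomℤ≡fallingℤ (a + + 1) (suc l) ⟩
    fallingℤ (a + + 1) (suc l)
      ≡⟨ fallingℤ-pascal a l ⟩
    fallingℤ a (suc l) + + suc l * fallingℤ a l
      ≡⟨ cong₂ (λ u v → u + + suc l * v) (!*binomℤ≡fallingℤ a (suc l)) (!*binomℤ≡fallingℤ a l) ⟨
    + (suc l !) * x + + suc l * (+ (l !) * y)
      ≡⟨ cong (λ f → f * x + + suc l * (+ (l !) * y)) (ℤ.pos-* (suc l) (l !)) ⟩
    + suc l * + (l !) * x + + suc l * (+ (l !) * y)
      ≡⟨ identity (+ suc l) (+ (l !)) x y ⟩
    + suc l * + (l !) * (x + y)
      ≡⟨ cong (_* (x + y)) (ℤ.pos-* (suc l) (l !)) ⟨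
    + (suc l !) * (x + y)
      ∎)
    where
    x y : ℤ
    x = binomℤ a (suc l)
    y = binomℤ a l
    identity : ∀ s f x y → s * f * x + s * (f * y) ≡ s * f * (x + y)
    identity = solve-∀

  binomℤ-0-suc : ∀ l → binomℤ (+ 0) (suc l) ≡ + 0
  binomℤ-0-suc l = ℤ.*-cancelˡ-≡ (+ (suc l !)) _ _ {{suc l !≢0}}
    (trans (!*binomℤ≡fallingℤ (+ 0) (suc l))
           (trans (fallingℤ-0-suc l) (sym (ℤ.*-zeroʳ (+ (suc l !))))))

k+p≡n+j⇔q+j+n≡e+L : ∀ {q p e l k L} n j → q ℕ.+ p ≡ e ℕ.+ l → k ℕ.+ l ≡ L →
                     (k ℕ.+ p ≡ n ℕ.+ j) ⇔ (q ℕ.+ j ℕ.+ n ≡ e ℕ.+ L)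
k+p≡n+j⇔q+j+n≡e+L {q} {p} {e} {l} {k} {L} n j q+p≡e+l k+l≡L = mk⇔
  (λ k+p≡n+j → ≡.trans (≡.sym q+[n+j]≡q+j+n)
                       (≡.trans (≡.cong (q ℕ.+_) (≡.sym k+p≡n+j)) q+[k+p]≡e+L))
  (λ q+j+n≡e+L → ℕ.+-cancelˡ-≡ q _ _
                   (≡.trans q+[k+p]≡e+L (≡.trans (≡.sym q+j+n≡e+L) (≡.sym q+[n+j]≡q+j+n))))
  where
  open ≡.≡-Reasoning
  q+[n+j]≡q+j+n : q ℕ.+ (n ℕ.+ j) ≡ q ℕ.+ j ℕ.+ n
  q+[n+j]≡q+j+n = ℕ+.x∙yz≈xz∙y q n j
  q+[k+p]≡e+L : q ℕ.+ (k ℕ.+ p) ≡ e ℕ.+ L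
  q+[k+p]≡e+L = begin
    q ℕ.+ (k ℕ.+ p)  ≡⟨ ℕ+.x∙yz≈y∙xz q k p ⟩
    k ℕ.+ (q ℕ.+ p)  ≡⟨ ≡.cong (k ℕ.+_) q+p≡e+l ⟩
    k ℕ.+ (e ℕ.+ l)  ≡⟨ ℕ+.x∙yz≈y∙xz k e l ⟩
    e ℕ.+ (k ℕ.+ l)  ≡⟨ ≡.cong (e ℕ.+_) k+l≡L ⟩
    e ℕ.+ L          ∎

module _ {c ℓ : Level} (R : CommutativeRing c ℓ) where
  open CommutativeRing R hiding (zero)
  open Series R
  open import Relation.Binary.Reasoning.Setoid setoid
  open import Algebra.Properties.Ring ring using (-0#≈0#; -‿+-comm; xyx⁻¹≈y; +-cancelʳ)
  open CommutativeSemigroupProperties +-commutativeSemigroup using () renaming (interchange to +-interchange)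
  open CommutativeSemigroupProperties *-commutativeSemigroup using () renaming (interchange to *-interchange)

  ≡⇒≈ : ∀ {x y} → x ≡ y → x ≈ y
  ≡⇒≈ ≡.refl = refl

  natR-+ : ∀ m n → natR (m ℕ.+ n) ≈ natR m + natR n
  natR-+ zero    n = sym (+-identityˡ _)
  natR-+ (suc m) n = trans (+-congˡ (natR-+ m n)) (sym (+-assoc _ _ _))

  intR-⊖ : ∀ m n → intR (m ℤ.⊖ n) ≈ natR m - natR n
  intR-⊖ m       zero    = begin
    intR (m ℤ.⊖ 0)   ≡⟨ ≡.cong intR (ℤ.⊖-≥ {m} z≤n) ⟩
    natR m           ≈⟨ +-identityʳ (natR m) ⟨
    natR m + 0#      ≈⟨ +-congˡ -0#≈0# ⟨
    natR m - natR 0  ∎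
  intR-⊖ zero    (suc n) =
    trans (≡⇒≈ (≡.cong intR (ℤ.⊖-< {0} {suc n} (s≤s z≤n)))) (sym (+-identityˡ _))
  intR-⊖ (suc m) (suc n) = begin
    intR (suc m ℤ.⊖ suc n)             ≡⟨ ≡.cong intR (ℤ.[1+m]⊖[1+n]≡m⊖n m n) ⟩
    intR (m ℤ.⊖ n)                     ≈⟨ intR-⊖ m n ⟩
    natR m - natR n                    ≈⟨ +-congʳ (xyx⁻¹≈y 1# (natR m)) ⟨
    (1# + natR m - 1#) - natR n        ≈⟨ +-assoc _ _ _ ⟩
    (1# + natR m) + (- 1# + - natR n)  ≈⟨ +-congˡ (-‿+-comm 1# (natR n)) ⟩
    natR (suc m) - natR (suc n)        ∎

  intR-+ : ∀ x y → intR (x ℤ.+ y) ≈ intR x + intR y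
  intR-+ (+ m)    (+ n)    = natR-+ m n
  intR-+ (+ m)    -[1+ n ] = intR-⊖ m (suc n)
  intR-+ -[1+ m ] (+ n)    = trans (intR-⊖ n (suc m)) (+-comm _ _)
  intR-+ -[1+ m ] -[1+ n ] = begin
    - natR (suc (suc (m ℕ.+ n)))     ≡⟨ ≡.cong (λ k → - natR (suc k)) (ℕ.+-suc m n) ⟨
    - natR (suc m ℕ.+ suc n)         ≈⟨ -‿cong (natR-+ (suc m) (suc n)) ⟩
    - (natR (suc m) + natR (suc n))  ≈⟨ -‿+-comm _ _ ⟨
    - natR (suc m) + - natR (suc n)  ∎

  sumR-cong : ∀ N {f g} → (∀ i → i < N → f i ≈ g i) → sumR N f ≈ sumR N g
  sumR-cong zero    f≈g = refl
  sumR-cong (suc N) f≈g =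
    +-cong (sumR-cong N (λ i i<N → f≈g i (ℕ.m<n⇒m<1+n i<N))) (f≈g N (ℕ.n<1+n N))

  sumR-≈0 : ∀ N {f} → (∀ i → i < N → f i ≈ 0#) → sumR N f ≈ 0#
  sumR-≈0 zero    f≈0 = refl
  sumR-≈0 (suc N) f≈0 =
    trans (+-cong (sumR-≈0 N (λ i i<N → f≈0 i (ℕ.m<n⇒m<1+n i<N))) (f≈0 N (ℕ.n<1+n N)))
          (+-identityˡ 0#)

  sumR-*ˡ : ∀ N x f → sumR N (λ i → x * f i) ≈ x * sumR N f
  sumR-*ˡ zero    x f = sym (zeroʳ x)
  sumR-*ˡ (suc N) x f = trans (+-congʳ (sumR-*ˡ N x f)) (sym (distribˡ x _ _))

  sumR-*ʳ : ∀ N f x → sumR N (λ i → f i * x) ≈ sumR N f * x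
  sumR-*ʳ zero    f x = sym (zeroˡ x)
  sumR-*ʳ (suc N) f x = trans (+-congʳ (sumR-*ʳ N f x)) (sym (distribʳ x _ _))

  sumR-+ : ∀ N f g → sumR N (λ i → f i + g i) ≈ sumR N f + sumR N g
  sumR-+ zero    f g = sym (+-identityˡ 0#)
  sumR-+ (suc N) f g = trans (+-congʳ (sumR-+ N f g)) (+-interchange _ _ (f N) (g N))

  sumR-suc : ∀ N f → sumR (suc N) f ≈ f 0 + sumR N (λ i → f (suc i))
  sumR-suc zero    f = trans (+-identityˡ _) (sym (+-identityʳ _))
  sumR-suc (suc N) f = trans (+-congʳ (sumR-suc N f)) (+-assoc _ _ _)

  sumR-extend : ∀ M N {f} → M ≤ N → (∀ i → M ≤ i → i < N → f i ≈ 0#) →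
                sumR N f ≈ sumR M f
  sumR-extend M N       M≤N f≈0 with ℕ.m≤n⇒m<n∨m≡n M≤N
  ... | inj₂ ≡.refl = refl
  sumR-extend M (suc N) M≤N f≈0 | inj₁ (s≤s M≤N′) =
    trans (+-cong (sumR-extend M N M≤N′ (λ i M≤i i<N → f≈0 i M≤i (ℕ.m<n⇒m<1+n i<N)))
                  (f≈0 N M≤N′ (ℕ.n<1+n N)))
          (+-identityʳ _)

  sumR-single : ∀ N f k → k < N → (∀ i → i < N → i ≢ k → f i ≈ 0#) → sumR N f ≈ f k
  sumR-single (suc N) f k k<1+N f≈0 with ℕ.m≤n⇒m<n∨m≡n (ℕ.≤-pred k<1+N)
  ... | inj₂ ≡.refl =
    trans (+-congʳ (sumR-≈0 N (λ i i<N → f≈0 i (ℕ.m<n⇒m<1+n i<N) (ℕ.<⇒≢ i<N)))) (+-identityˡ _)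
  ... | inj₁ k<N    =
    trans (+-cong (sumR-single N f k k<N (λ i i<N → f≈0 i (ℕ.m<n⇒m<1+n i<N)))
                  (f≈0 N (ℕ.n<1+n N) (λ N≡k → ℕ.<⇒≢ k<N (≡.sym N≡k))))
          (+-identityʳ _)

  [∧]R : ∀ x y → [ x ∧ y ]R ≈ [ x ]R * [ y ]R
  [∧]R false y = sym (zeroˡ _)
  [∧]R true  y = sym (*-identityˡ _)

  indicator-true : ∀ {x} z → T x → [ x ]R * z ≈ z
  indicator-true {true} z _ = *-identityˡ z

  indicator-false : ∀ {x} z → ¬ T x → [ x ]R * z ≈ 0#
  indicator-false {false} z _  = zeroˡ z
  indicator-false {true}  z ¬t = ⊥-elim (¬t tt)

  indicator-cong : ∀ {x y} z → (T x → T y) → (T y → T x) → [ x ]R * z ≈ [ y ]R * z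
  indicator-cong {false} {false} z _ _ = refl
  indicator-cong {false} {true}  z _ g = ⊥-elim (g tt)
  indicator-cong {true}  {false} z f _ = ⊥-elim (f tt)
  indicator-cong {true}  {true}  z _ _ = refl

  sumR-indicator-unique : ∀ N (g : ℕ → Bool) (f : ℕ → Carrier) k → k < N →
                          (∀ i → T (g i) → i ≡ k) →
                          sumR N (λ i → [ g i ]R * f i) ≈ [ g k ]R * f k
  sumR-indicator-unique N g f k k<N unique = sumR-single N (λ i → [ g i ]R * f i) k k<N
    (λ i _ i≢k → indicator-false (f i) (λ t → i≢k (unique i t)))

  sumR²-indicator≈⊛ : ∀ M N (f g : PS) → N < M →
    sumR M (λ i → sumR M (λ j → [ (i ℕ.+ j) ≡ᵇ N ]R * (f i * g j))) ≈ (f ⊛ g) N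
  sumR²-indicator≈⊛ M N f g N<M = trans (sumR-extend (suc N) M N<M outside) (sumR-cong (suc N) inside)
    where
    row : ℕ → Carrier
    row i = sumR M (λ j → [ (i ℕ.+ j) ≡ᵇ N ]R * (f i * g j))
    inside : ∀ i → i < suc N → row i ≈ f i * g (N ∸ i)
    inside i (s≤s i≤N) =
      trans (sumR-indicator-unique M (λ j → (i ℕ.+ j) ≡ᵇ N) (λ j → f i * g j) (N ∸ i)
               (ℕ.≤-<-trans (ℕ.m∸n≤m N i) N<M)
               (λ j t → ≡.trans (≡.sym (ℕ.m+n∸m≡n i j)) (≡.cong (_∸ i) (ℕ.≡ᵇ⇒≡ _ _ t))))
            (indicator-true (f i * g (N ∸ i)) (ℕ.≡⇒≡ᵇ _ _ (ℕ.m+[n∸m]≡n i≤N)))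
    outside : ∀ i → suc N ≤ i → i < M → row i ≈ 0#
    outside i N<i _ = sumR-≈0 M λ j _ → indicator-false (f i * g j)
      (λ t → ℕ.<⇒≱ N<i (≡.subst (i ≤_) (ℕ.≡ᵇ⇒≡ _ _ t) (ℕ.m≤m+n i j)))

  indicator-∧-interchange : ∀ x y a b p h →
    [ x ∧ y ]R * (a * b * p * h) ≈ ([ x ]R * (a * b)) * ([ y ]R * (p * h))
  indicator-∧-interchange x y a b p h =
    trans (*-cong ([∧]R x y) (*-assoc (a * b) p h)) (*-interchange [ x ]R [ y ]R (a * b) (p * h))

  sumR⁴≈sumR²*sumR² : ∀ N (F G : ℕ → ℕ → Carrier) →
    (sumR N λ i → sumR N λ j → sumR N λ q → sumR N λ r → F i j * G q r)
      ≈ (sumR N λ i → sumR N (F i)) * (sumR N λ q → sumR N (G q))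
  sumR⁴≈sumR²*sumR² N F G = begin
    (sumR N λ i → sumR N λ j → sumR N λ q → sumR N λ r → F i j * G q r)
      ≈⟨ (sumR-cong N λ i _ → sumR-cong N λ j _ →
            trans (sumR-cong N (λ q _ → sumR-*ˡ N (F i j) (G q)))
                  (sumR-*ˡ N (F i j) (λ q → sumR N (G q)))) ⟩
    (sumR N λ i → sumR N λ j → F i j * ΣG)
      ≈⟨ trans (sumR-cong N (λ i _ → sumR-*ʳ N (F i) ΣG))
               (sumR-*ʳ N (λ i → sumR N (F i)) ΣG) ⟩
    (sumR N λ i → sumR N (F i)) * ΣG ∎
    where
    ΣG : Carrier
    ΣG = sumR N λ q → sumR N (G q)

  binomR : ℤ → PS
  binomR a l = intR (binomℤ a l)

  binomR-pascal : ∀ a l → binomR (a ℤ.+ + 1) (suc l) ≈ binomR a (suc l) + binomR a l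
  binomR-pascal a l =
    trans (≡⇒≈ (≡.cong intR (binomℤ-pascal a l))) (intR-+ (binomℤ a (suc l)) (binomℤ a l))

  ⊛-binomR-+1 : ∀ a g L →
                (binomR (a ℤ.+ + 1) ⊛ g) (suc L) ≈ (binomR a ⊛ g) (suc L) + (binomR a ⊛ g) L
  ⊛-binomR-+1 a g L = begin
    (binomR (a ℤ.+ + 1) ⊛ g) (suc L)
      ≈⟨ sumR-suc (suc L) _ ⟩
    head + sumR (suc L) (λ i → binomR (a ℤ.+ + 1) (suc i) * g (L ∸ i))
      ≈⟨ +-congˡ (sumR-cong (suc L) (λ i _ → *-congʳ (binomR-pascal a i))) ⟩
    head + sumR (suc L) (λ i → (binomR a (suc i) + binomR a i) * g (L ∸ i))
      ≈⟨ +-congˡ (trans (sumR-cong (suc L) (λ i _ → distribʳ _ _ _)) (sumR-+ (suc L) _ _)) ⟩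
    head + (sumR (suc L) (λ i → binomR a (suc i) * g (L ∸ i)) + (binomR a ⊛ g) L)
      ≈⟨ +-assoc _ _ _ ⟨
    (head + sumR (suc L) (λ i → binomR a (suc i) * g (L ∸ i))) + (binomR a ⊛ g) L
      ≈⟨ +-congʳ (sumR-suc (suc L) _) ⟨
    (binomR a ⊛ g) (suc L) + (binomR a ⊛ g) L ∎
    where
    head : Carrier
    head = binomR a 0 * g (suc L)

  ⊛-binomR : ∀ L a b → (binomR a ⊛ binomR b) L ≈ binomR (a ℤ.+ b) L
  ⊛-binomR zero    a b = trans (+-identityˡ _) (trans (*-congʳ (+-identityʳ 1#)) (*-identityˡ _))
  ⊛-binomR (suc L) a b = ℤ-induction Vandermonde base up down a
    where
    Vandermonde : ℤ → Set ℓ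
    Vandermonde a = (binomR a ⊛ binomR b) (suc L) ≈ binomR (a ℤ.+ b) (suc L)
    pascal : ∀ a →
             binomR ((a ℤ.+ + 1) ℤ.+ b) (suc L) ≈ binomR (a ℤ.+ b) (suc L) + (binomR a ⊛ binomR b) L
    pascal a = begin
      binomR ((a ℤ.+ + 1) ℤ.+ b) (suc L)                  ≡⟨ ≡.cong (λ x → binomR x (suc L))
                                                                     (ℤ+.xy∙z≈xz∙y a b (+ 1)) ⟨
      binomR ((a ℤ.+ b) ℤ.+ + 1) (suc L)                  ≈⟨ binomR-pascal (a ℤ.+ b) L ⟩
      binomR (a ℤ.+ b) (suc L) + binomR (a ℤ.+ b) L       ≈⟨ +-congˡ (⊛-binomR L a b) ⟨
      binomR (a ℤ.+ b) (suc L) + (binomR a ⊛ binomR b) L  ∎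
    base : Vandermonde (+ 0)
    base = begin
      (binomR (+ 0) ⊛ binomR b) (suc L) ≈⟨ sumR-single (suc (suc L)) _ 0 (s≤s z≤n) vanish ⟩
      binomR (+ 0) 0 * binomR b (suc L) ≈⟨ trans (*-congʳ (+-identityʳ 1#)) (*-identityˡ _) ⟩
      binomR b (suc L)                  ≡⟨ ≡.cong (λ x → binomR x (suc L)) (ℤ.+-identityˡ b) ⟨
      binomR (+ 0 ℤ.+ b) (suc L)        ∎
      where
      vanish : ∀ i → i < suc (suc L) → i ≢ 0 → binomR (+ 0) i * binomR b (suc L ∸ i) ≈ 0#
      vanish zero    _ 0≢0 = ⊥-elim (0≢0 ≡.refl)
      vanish (suc i) _ _   = trans (*-congʳ (≡⇒≈ (≡.cong intR (binomℤ-0-suc i)))) (zeroˡ _)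
    up : ∀ a → Vandermonde a → Vandermonde (a ℤ.+ + 1)
    up a IH = trans (⊛-binomR-+1 a (binomR b) L) (trans (+-congʳ IH) (sym (pascal a)))
    down : ∀ a → Vandermonde (a ℤ.+ + 1) → Vandermonde a
    down a IH = +-cancelʳ ((binomR a ⊛ binomR b) L) _ _
      (trans (sym (⊛-binomR-+1 a (binomR b) L)) (trans IH (pascal a)))

  prodS-linS-vanishes : ∀ k (y : Fin k → Carrier) q → k < q → prodS k (λ i → linS (y i)) q ≈ 0#
  prodS-linS-vanishes zero    y (suc q)       _               = refl
  prodS-linS-vanishes (suc k) y (suc (suc q)) (s≤s (s≤s k≤q)) = sumR-≈0 (suc (suc (suc q))) vanish
    where
    rest : PS
    rest = prodS k (λ i → linS (y (Fin.suc i)))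
    vanish : ∀ i → i < suc (suc (suc q)) → linS (y Fin.zero) i * rest (suc (suc q) ∸ i) ≈ 0#
    vanish zero          _ =
      trans (*-congˡ (prodS-linS-vanishes k _ (suc (suc q)) (s≤s (ℕ.m≤n⇒m≤1+n k≤q)))) (zeroʳ _)
    vanish (suc zero)    _ = trans (*-congˡ (prodS-linS-vanishes k _ (suc q) (s≤s k≤q))) (zeroʳ _)
    vanish (suc (suc i)) _ = zeroˡ _

  module CoefficientOfF (A B : ℤ) (m n d : ℕ) (0<m : 0 < m)
                        (b : Fin n → Carrier) (c : Fin (m ∸ 1) → Carrier) (L : ℕ) where

    Nb K : ℕ
    Nb = 2 ℕ.* L ℕ.+ m ℕ.+ d ℕ.+ n ℕ.+ 2
    K  = m ℕ.+ d ℕ.+ L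

    P H : PS
    P = prodS (m ∸ 1) (λ k → linS (- c k))
    H = prodS n (λ k → geomS (b k))

    term : ℕ → ℕ → ℕ → ℕ → Carrier
    term l₁ l₂ q j = binomR A l₁ * binomR B l₂ * P q * H j

    ≤K⇒<Nb : ∀ {x} → x ≤ K → x < Nb
    ≤K⇒<Nb x≤K =
      ℕ.≤-trans (s≤s x≤K)
                (≡.subst (suc K ≤_) (≡.sym (Nb≡ L m d n)) (ℕ.m≤m+n (suc K) (L ℕ.+ n ℕ.+ 1)))
      where
      open import Data.Nat.Tactic.RingSolver using (solve-∀)
      Nb≡ : ∀ L m d n →
            2 ℕ.* L ℕ.+ m ℕ.+ d ℕ.+ n ℕ.+ 2 ≡ suc (m ℕ.+ d ℕ.+ L) ℕ.+ (L ℕ.+ n ℕ.+ 1)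
      Nb≡ = solve-∀

    p-constraints : ℕ → ℕ → ℕ → ℕ → ℕ → Bool
    p-constraints l₁ l₂ q j p =
      ((q ℕ.+ p) ≡ᵇ (m ℕ.+ d ℕ.+ l₂)) ∧ ((l₁ ℕ.+ p) ≡ᵇ (n ℕ.+ j)) ∧ (1 ≤ᵇ p)

    sumR-over-p-solvable : ∀ l₁ l₂ q j → l₁ ℕ.+ l₂ ≡ L → q < m →
      sumR Nb (λ p → [ p-constraints l₁ l₂ q j p ]R * term l₁ l₂ q j)
        ≈ [ (q ℕ.+ j ℕ.+ n) ≡ᵇ K ]R * term l₁ l₂ q j
    sumR-over-p-solvable l₁ l₂ q j l₁+l₂≡L q<m =
      trans (sumR-indicator-unique Nb (p-constraints l₁ l₂ q j) (λ _ → term l₁ l₂ q j) p₀ p₀<Nb unique)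
            (indicator-cong (term l₁ l₂ q j) to from)
      where
      p₀ : ℕ
      p₀ = m ℕ.+ d ℕ.+ l₂ ∸ q
      m≤ : m ≤ m ℕ.+ d ℕ.+ l₂
      m≤ = ℕ.≤-trans (ℕ.m≤m+n m d) (ℕ.m≤m+n (m ℕ.+ d) l₂)
      q+p₀≡ : q ℕ.+ p₀ ≡ m ℕ.+ d ℕ.+ l₂
      q+p₀≡ = ℕ.m+[n∸m]≡n (ℕ.≤-trans (ℕ.<⇒≤ q<m) m≤)
      p₀<Nb : p₀ < Nb
      p₀<Nb = ≤K⇒<Nb (ℕ.≤-trans (ℕ.m∸n≤m _ q)
                               (ℕ.+-monoʳ-≤ (m ℕ.+ d) (≡.subst (l₂ ≤_) l₁+l₂≡L (ℕ.m≤n+m l₂ l₁))))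
      unique : ∀ p → T (p-constraints l₁ l₂ q j p) → p ≡ p₀
      unique p t =
        ≡.trans (≡.sym (ℕ.m+n∸m≡n q p)) (≡.cong (_∸ q) (ℕ.≡ᵇ⇒≡ _ _ (proj₁ (Equivalence.to T-∧ t))))
      shell : (l₁ ℕ.+ p₀ ≡ n ℕ.+ j) ⇔ (q ℕ.+ j ℕ.+ n ≡ K)
      shell = k+p≡n+j⇔q+j+n≡e+L n j q+p₀≡ l₁+l₂≡L
      to : T (p-constraints l₁ l₂ q j p₀) → T ((q ℕ.+ j ℕ.+ n) ≡ᵇ K)
      to t = ℕ.≡⇒≡ᵇ _ _ (Equivalence.to shell (ℕ.≡ᵇ⇒≡ _ _ l₁+p₀≡n+j))
        where
        l₁+p₀≡n+j : T ((l₁ ℕ.+ p₀) ≡ᵇ (n ℕ.+ j))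
        l₁+p₀≡n+j = proj₁ (Equivalence.to T-∧ (proj₂ (Equivalence.to (T-∧ {(q ℕ.+ p₀) ≡ᵇ _}) t)))
      from : T ((q ℕ.+ j ℕ.+ n) ≡ᵇ K) → T (p-constraints l₁ l₂ q j p₀)
      from t = Equivalence.from T-∧
                 (ℕ.≡⇒≡ᵇ (q ℕ.+ p₀) _ q+p₀≡ , Equivalence.from T-∧ (l₁+p₀≡n+j , 1≤p₀))
        where
        l₁+p₀≡n+j : T ((l₁ ℕ.+ p₀) ≡ᵇ (n ℕ.+ j))
        l₁+p₀≡n+j = ℕ.≡⇒≡ᵇ _ _ (Equivalence.from shell (ℕ.≡ᵇ⇒≡ _ _ t))
        1≤p₀ : T (1 ≤ᵇ p₀)
        1≤p₀ = ℕ.≤⇒≤ᵇ (ℕ.m<n⇒0<n∸m (ℕ.<-≤-trans q<m m≤))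

    -- When q ≥ m the value m + d + l₂ - q forced on p may be non-positive, but then P q = 0.
    sumR-over-p : ∀ l₁ l₂ q j →
      sumR Nb (λ p → [ ((l₁ ℕ.+ l₂) ≡ᵇ L) ∧ p-constraints l₁ l₂ q j p ]R * term l₁ l₂ q j)
        ≈ [ ((l₁ ℕ.+ l₂) ≡ᵇ L) ∧ ((q ℕ.+ j ℕ.+ n) ≡ᵇ K) ]R * term l₁ l₂ q j
    sumR-over-p l₁ l₂ q j with (l₁ ℕ.+ l₂) ≡ᵇ L in l₁+l₂≡ᵇL | q ℕ.<? m
    ... | false | _       = trans (sumR-≈0 Nb (λ _ _ → zeroˡ _)) (sym (zeroˡ _))
    ... | true  | yes q<m =
      sumR-over-p-solvable l₁ l₂ q j (ℕ.≡ᵇ⇒≡ _ _ (≡.subst T (≡.sym l₁+l₂≡ᵇL) tt)) q<m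
    ... | true  | no  q≮m = trans (sumR-≈0 Nb (λ _ _ → trans (*-congˡ term≈0) (zeroʳ _)))
                                  (sym (trans (*-congˡ term≈0) (zeroʳ _)))
      where
      m∸1<q : m ∸ 1 < q
      m∸1<q = ≡.subst (_≤ q) (≡.sym (ℕ.suc-pred m {{ℕ.>-nonZero 0<m}})) (ℕ.≮⇒≥ q≮m)
      term≈0 : term l₁ l₂ q j ≈ 0#
      term≈0 = trans (*-congʳ (trans (*-congˡ (prodS-linS-vanishes (m ∸ 1) (λ k → - c k) q m∸1<q))
                                     (zeroʳ _)))
                     (zeroˡ _)

    binomialFactor hFactor : Carrier
    binomialFactor =
      sumR Nb λ l₁ → sumR Nb λ l₂ → [ (l₁ ℕ.+ l₂) ≡ᵇ L ]R * (binomR A l₁ * binomR B l₂)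
    hFactor =
      sumR Nb λ q → sumR Nb λ j → [ (q ℕ.+ j ℕ.+ n) ≡ᵇ K ]R * (P q * H j)

    coeffF≈binomialFactor*hFactor : coeffF A B m n d b c L ≈ binomialFactor * hFactor
    coeffF≈binomialFactor*hFactor =
      trans (sumR-cong Nb λ l₁ _ → sumR-cong Nb λ l₂ _ → sumR-cong Nb λ q _ → sumR-cong Nb λ j _ →
               trans (sumR-over-p l₁ l₂ q j)
                     (indicator-∧-interchange ((l₁ ℕ.+ l₂) ≡ᵇ L) ((q ℕ.+ j ℕ.+ n) ≡ᵇ K) _ _ _ _))
            (sumR⁴≈sumR²*sumR² Nb _ _)

    binomialFactor≈ : binomialFactor ≈ binomR (A ℤ.+ B) L
    binomialFactor≈ =
      trans (sumR²-indicator≈⊛ Nb L (binomR A) (binomR B) (≤K⇒<Nb (ℕ.m≤n+m L (m ℕ.+ d))))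
            (⊛-binomR L A B)

    hS : ℤ → Carrier
    hS = hSuper n (m ∸ 1) b (λ k → - c k)

    z : ℤ
    z = (+ L ℤ.- + n) ℤ.+ + (m ℕ.+ d)

    z≡K⊖n : z ≡ K ℤ.⊖ n
    z≡K⊖n = ≡.trans (ℤ+.xy∙z≈zx∙y (+ L) (ℤ.- + n) (+ (m ℕ.+ d)))
                    (≡.trans (≡.cong (ℤ._- + n) (≡.sym (ℤ.pos-+ (m ℕ.+ d) L))) (ℤ.m-n≡m⊖n K n))

    hFactor≈ : hFactor ≈ hS z
    hFactor≈ with n ℕ.≤? K
    ... | yes n≤K = begin
      hFactor
        ≈⟨ (sumR-cong Nb λ q _ → sumR-cong Nb λ j _ → shell q j) ⟩
      (sumR Nb λ q → sumR Nb λ j → [ (q ℕ.+ j) ≡ᵇ (K ∸ n) ]R * (P q * H j))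
        ≈⟨ sumR²-indicator≈⊛ Nb (K ∸ n) P H (≤K⇒<Nb (ℕ.m∸n≤m K n)) ⟩
      hS (+ (K ∸ n))
        ≡⟨ ≡.cong hS (≡.trans z≡K⊖n (ℤ.⊖-≥ n≤K)) ⟨
      hS z
        ∎
      where
      shell : ∀ q j →
              [ (q ℕ.+ j ℕ.+ n) ≡ᵇ K ]R * (P q * H j) ≈ [ (q ℕ.+ j) ≡ᵇ (K ∸ n) ]R * (P q * H j)
      shell q j = indicator-cong (P q * H j)
        (λ t → ℕ.≡⇒≡ᵇ _ _ (≡.trans (≡.sym (ℕ.m+n∸n≡m (q ℕ.+ j) n))
                                   (≡.cong (_∸ n) (ℕ.≡ᵇ⇒≡ (q ℕ.+ j ℕ.+ n) K t))))
        (λ t → ℕ.≡⇒≡ᵇ _ _ (≡.trans (≡.cong (ℕ._+ n) (ℕ.≡ᵇ⇒≡ (q ℕ.+ j) (K ∸ n) t))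
                                   (ℕ.m∸n+n≡m n≤K)))
    ... | no  n≰K = begin
      hFactor              ≈⟨ (sumR-≈0 Nb λ q _ → sumR-≈0 Nb λ j _ →
                                 indicator-false (P q * H j) (off-shell q j)) ⟩
      0#                   ≈⟨ hS-negative (n ∸ K) (ℕ.m<n⇒0<n∸m (ℕ.≰⇒> n≰K)) ⟨
      hS (ℤ.- + (n ∸ K))   ≡⟨ ≡.cong hS (≡.trans z≡K⊖n (ℤ.⊖-< (ℕ.≰⇒> n≰K))) ⟨
      hS z                 ∎
      where
      off-shell : ∀ q j → ¬ T ((q ℕ.+ j ℕ.+ n) ≡ᵇ K)
      off-shell q j t = n≰K (≡.subst (n ≤_) (ℕ.≡ᵇ⇒≡ _ _ t) (ℕ.m≤n+m n (q ℕ.+ j)))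
      hS-negative : ∀ x → 0 < x → hS (ℤ.- + x) ≈ 0#
      hS-negative (suc x) _ = refl

lemma3p17 : {ℓc ℓ : Level} (R : CommutativeRing ℓc ℓ) →
    let open CommutativeRing R in let open Series R in
    (A B : ℤ) (m n d : ℕ) → 0 < m →
    (b : Fin n → Carrier) (c : Fin (m ∸ 1) → Carrier) →
    (L : ℕ) →
    coeffF A B m n d b c L
      ≈ intR (binomℤ (A Data.Integer.+ B) L)
        * hSuper n (m ∸ 1) b (λ k → - c k)
            ((Data.Integer.+ L Data.Integer.- Data.Integer.+ n)
               Data.Integer.+ Data.Integer.+ (m Data.Nat.+ d))
lemma3p17 R A B m n d 0<m b c L =
  trans coeffF≈binomialFactor*hFactor (*-cong binomialFactor≈ hFactor≈)
  where
  open CommutativeRing R using (trans; *-cong)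
  open CoefficientOfF R A B m n d 0<m b c L
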